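{- Let $\alpha\subseteq\{+,-\}$ with $\alpha\neq\emptyset$, $s\in\mathbb{N}$, $\mathcal{C}=\mathcal{C}_{\alpha,s}$, and let $F$ be a CNF formula. If there is a $\mathcal{C}$-obstruction tree of depth $d$ in $F$, then the $\mathcal{C}$-backdoor depth of $F$ is larger than $d$.
   Context: A clause is a finite set of literals with no complementary pair; a CNF formula is a finite set of clauses. For a partial assignment $\beta$, $F[\beta]$ is obtained by deleting clauses containing a true literal and deleting false literals from the remaining clauses. The incidence graph of $F$ is the bipartite graph between variables and clauses ($x$ adjacent to $c$ iff $x$ or $\neg x$ is in $c$); connectivity, components $\mathrm{Conn}(F)$ and paths of $F$ refer to this graph. A literal is an $\alpha$-literal if it is positive and $+\in\alpha$, or negative and $-\in\alpha$; $\mathcal{C}_{\alpha,s}$ is the class of CNF formulas each clause of which has at most $s$ $\alpha$-literals. A clause $c$ is $\mathcal{C}$-bad if $\{c\}\notin\mathcal{C}$. $\mathcal{C}$-obstruction trees are defined inductively: if $c$ is a $\mathcal{C}$-bad clause of $F$, then $\{c\}$ is a $\mathcal{C}$-obstruction tree in $F$ of depth 0. If $T_1$ is a $\mathcal{C}$-obstruction tree of depth $i$ in $F$, $\beta$ is a partial assignment of variables of $F$, $T_2$ is a $\mathcal{C}$-obstruction tree of depth $i$ in $F[\beta]$ such that no variable $v\in\mathit{var}(F[\beta])$ occurs both in a clause of $T_1$ and in a clause of $T_2$, and $P$ (a set of clauses representing a path) is a path in the incidence graph of $F$ connecting $T_1$ and $T_2$, then $T_1\cup T_2\cup\mathit{var}(P)\cup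 P$ is a $\mathcal{C}$-obstruction tree in $F$ of depth $i+1$. The $\mathcal{C}$-backdoor depth $\mathrm{depth}_{\mathcal{C}}(F)$ is $0$ if $F\in\mathcal{C}$; if $F\notin\mathcal{C}$ and $F$ is connected it is $1+\min_{x\in\mathit{var}(F)}\max_{\epsilon\in\{0,1\}}\mathrm{depth}_{\mathcal{C}}(F[x=\epsilon])$; otherwise it is $\max_{F'\in\mathrm{Conn}(F)}\mathrm{depth}_{\mathcal{C}}(F')$. -}

module Defs where

open import Data.Nat using (ℕ; zero; suc; _≤_; _<_; _≡ᵇ_)
open import Data.Bool using (Bool; true; false; not; if_then_else_; _∨_; _∧_; T)
open import Data.Maybe using (Maybe; just; nothing)
open import Data.Product using (Σ; _×_; _,_; proj₁; proj₂)
open import Data.Sum using (_⊎_; inj₁; inj₂)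
open import Data.List using (List; []; _∷_; _++_; map; filterᵇ; length; [_])
open import Data.Bool.ListAction using (any)
open import Data.List.Membership.Propositional using (_∈_)
open import Data.List.Relation.Unary.All using (All)
open import Data.List.Relation.Unary.Any using (Any)
open import Data.List.Relation.Unary.Unique.Propositional using (Unique)
open import Relation.Binary.PropositionalEquality using (_≡_)
open import Relation.Nullary using (¬_)
open import Function.Bundles using (_⇔_)

-- A variable is a natural number.  A literal (x , b) is x if b = true
-- (positive) and ¬x if b = false (negative).
Var : Set
Var = ℕ

Lit : Set
Lit = Var × Bool

-- Clauses and formulas are represented by lists; all notions below only
-- depend on the underlying sets (list membership).
Clause : Set
Clause = List Lit

CNF : Set
CNF = List Clause

-- A clause is a *set* of literals (no repetitions) without complementary pair.
WFClause : Clause → Set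
WFClause c = Unique c × (∀ x → ¬ (((x , true) ∈ c) × ((x , false) ∈ c)))

WFCNF : CNF → Set
WFCNF F = All WFClause F

Occurs : Var → Clause → Set
Occurs x c = Any (λ l → proj₁ l ≡ x) c

VarOf : CNF → Var → Set
VarOf F x = Σ Clause λ c → (c ∈ F) × Occurs x c

PAssign : Set
PAssign = Var → Maybe Bool

eqMB : Maybe Bool → Maybe Bool → Bool
eqMB (just true)  (just true)  = true
eqMB (just false) (just false) = true
eqMB nothing      nothing      = true
eqMB _            _            = false

litTrue : PAssign → Lit → Bool
litTrue β (x , b) = eqMB (β x) (just b)

litFalse : PAssign → Lit → Bool
litFalse β (x , b) = eqMB (β x) (just (not b))

satisfiedC : PAssign → Clause → Bool
satisfiedC β c = any (litTrue β) c

reduceC : PAssign → Clause → Clause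
reduceC β c = filterᵇ (λ l → not (litFalse β l)) c

_⟦_⟧ : CNF → PAssign → CNF
F ⟦ β ⟧ = map (reduceC β) (filterᵇ (λ c → not (satisfiedC β c)) F)

_≔_ : Var → Bool → PAssign
(x ≔ ε) y = if y ≡ᵇ x then just ε else nothing

-- α ⊆ {+,-} is given by two booleans: (+ ∈ α , - ∈ α)
Sign : Set
Sign = Bool × Bool

NonEmptySign : Sign → Set
NonEmptySign (p , n) = T (p ∨ n)

isαLit : Sign → Lit → Bool
isαLit (p , n) (x , true)  = p
isαLit (p , n) (x , false) = n

#α : Sign → Clause → ℕ
#α α c = length (filterᵇ (isαLit α) c)

InC : Sign → ℕ → CNF → Set
InC α s F = All (λ c → #α α c ≤ s) F

Bad : Sign → ℕ → Clause → Set
Bad α s c = ¬ InC α s [ c ]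

Vertex : Set
Vertex = Var ⊎ Clause

VertexOf : CNF → Vertex → Set
VertexOf F (inj₁ x) = VarOf F x
VertexOf F (inj₂ c) = c ∈ F

data Adj (F : CNF) : Vertex → Vertex → Set where
  vc : ∀ {x c} → c ∈ F → Occurs x c → Adj F (inj₁ x) (inj₂ c)
  cv : ∀ {x c} → c ∈ F → Occurs x c → Adj F (inj₂ c) (inj₁ x)

data Walk (F : CNF) : Vertex → Vertex → Set where
  here : ∀ {u} → VertexOf F u → Walk F u u
  step : ∀ {u w v} → Adj F u w → Walk F w v → Walk F u v

walkVerts : ∀ {F u v} → Walk F u v → List Vertex
walkVerts (here {u} _) = u ∷ []
walkVerts (step {u} _ p) = u ∷ walkVerts p

IsPath : ∀ {F u v} → Walk F u v → Set
IsPath p = Unique (walkVerts p)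

clausesOf : List Vertex → List Clause
clausesOf [] = []
clausesOf (inj₁ x ∷ vs) = clausesOf vs
clausesOf (inj₂ c ∷ vs) = c ∷ clausesOf vs

varsOf : List Vertex → List Var
varsOf [] = []
varsOf (inj₁ x ∷ vs) = x ∷ varsOf vs
varsOf (inj₂ c ∷ vs) = varsOf vs

Connected : CNF → Set
Connected F = ∀ c c' → c ∈ F → c' ∈ F → Walk F (inj₂ c) (inj₂ c')

IsComponent : CNF → CNF → Set
IsComponent F F' =
  Σ Clause λ c → (c ∈ F) ×
    (∀ c' → (c' ∈ F') ⇔ ((c' ∈ F) × Walk F (inj₂ c) (inj₂ c')))

-- Backdoor depth, as the relation  depth_C(F) ≤ k
-- (exactly unfolds the recursive definition of depth_C)

data DepthLE (α : Sign) (s : ℕ) : CNF → ℕ → Set where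
  inC   : ∀ {F k} → InC α s F → DepthLE α s F k
  split : ∀ {F k} x → ¬ InC α s F → Connected F → VarOf F x →
          DepthLE α s (F ⟦ x ≔ false ⟧) k → DepthLE α s (F ⟦ x ≔ true ⟧) k →
          DepthLE α s F (suc k)
  disc  : ∀ {F k} → ¬ InC α s F → ¬ Connected F →
          (∀ F' → IsComponent F F' → DepthLE α s F' k) → DepthLE α s F k

-- A tree is recorded by its clause vertices and variable vertices.
record Tree : Set where
  constructor mkTree
  field
    tclauses : List Clause
    tvars    : List Var
open Tree public

InTree : Tree → Vertex → Set
InTree T (inj₁ x) = x ∈ tvars T
InTree T (inj₂ c) = c ∈ tclauses T

-- The clauses of a tree T₂ in F[β] are clauses of F[β]; in F they are
-- identified with original clauses of F (a list L of clauses of F, not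
-- satisfied by β, whose reducts are exactly the clauses of T₂).
data ObsTree (α : Sign) (s : ℕ) (F : CNF) : ℕ → Tree → Set where
  leaf : ∀ c → c ∈ F → Bad α s c → ObsTree α s F 0 (mkTree [ c ] [])
  node : ∀ {i} T₁ (β : PAssign) T₂ (L : List Clause) {u v} (P : Walk F u v) →
         ObsTree α s F i T₁ →
         ObsTree α s (F ⟦ β ⟧) i T₂ →
         (∀ x → VarOf (F ⟦ β ⟧) x →
            ¬ ((Σ Clause λ c → (c ∈ tclauses T₁) × Occurs x c) ×
               (Σ Clause λ c → (c ∈ tclauses T₂) × Occurs x c))) →
         All (λ c → (c ∈ F) × (satisfiedC β c ≡ false)) L →
         map (reduceC β) L ≡ tclauses T₂ →
         IsPath P →
         InTree T₁ u →
         InTree (mkTree L (tvars T₂)) v →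
         ObsTree α s F (suc i)
           (mkTree (tclauses T₁ ++ L ++ clausesOf (walkVerts P))
                   (tvars T₁ ++ tvars T₂ ++ varsOf (walkVerts P)))

{-# OPTIONS --safe #-}
module Submission where

open import Defs
open import Data.Bool using (Bool; true; false; not; T; _∧_)
import Data.Bool as Bool
open import Data.Bool.ListAction using (any)
open import Data.Bool.Properties using (T-not-≡)
open import Data.Empty using (⊥; ⊥-elim)
open import Data.List using (List; []; _∷_; _++_; map; filter; filterᵇ)
import Data.List.Properties as ListProp
open import Data.List.Membership.Propositional using (_∈_; find)
open import Data.List.Membership.Propositional.Properties
  using (∈-map⁺; ∈-map⁻; ∈-map∘filter⁻; ∈-map∘filter⁺; ∈-filter⁺; ∈-filter⁻; ∈-++⁻; ∈-++⁺ˡ; ∈-++⁺ʳ)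
open import Data.List.Relation.Unary.All using (All; []; _∷_)
import Data.List.Relation.Unary.All as All
open import Data.List.Relation.Unary.All.Properties using (¬Any⇒All¬)
open import Data.List.Relation.Unary.Any using (Any; here; there; any?)
import Data.List.Relation.Unary.Any as Any
open import Data.List.Relation.Binary.Subset.Propositional using (_⊆_)
import Data.List.Relation.Binary.Subset.Propositional.Properties as Subset
import Data.List.Relation.Binary.Sublist.Propositional.Properties as Sublist
open import Data.Maybe using (just; nothing; _<∣>_; fromMaybe)
open import Data.Maybe.Properties using (<∣>-identityʳ)
open import Data.Nat using (ℕ; suc; _≤_; z≤n; _≡ᵇ_; _≟_)
open import Data.Nat.Properties using (≤-trans; ≡ᵇ⇒≡)
open import Data.Product using (∃-syntax; _×_; _,_; proj₁; proj₂; curry)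
import Data.Product as Product
import Data.Product.Properties as ProductProp
open import Data.Sum using (_⊎_; inj₁; inj₂)
open import Function using (_∘_; id; case_of_)
open import Function.Bundles using (Equivalence; mk⇔)
open import Relation.Binary.Construct.Closure.ReflexiveTransitive using (Star; ε; _◅_; _◅◅_)
import Relation.Binary.Construct.Closure.ReflexiveTransitive as Star
open import Relation.Binary.Definitions using (DecidableEquality)
open import Relation.Binary.PropositionalEquality
  using (_≡_; _≢_; _≗_; refl; sym; trans; cong; subst)
open import Relation.Nullary using (¬_; Dec; yes; no)
open import Relation.Nullary.Decidable using (T?; _×-dec_; _⊎-dec_)

-- We prove, by induction on a derivation of depth_C(F) ≤ k, that no obstruction tree of
-- depth k (in whatever formula) has all its clauses in F[β] for a partial assignment β.
-- If F ∈ C then so is F[β], while every obstruction tree contains a bad clause.  If F is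
-- split on x, the two subtrees of a tree of depth k + 1 share no variable, so one of them
-- avoids x; its clauses lie in F[β] or in F[β][γ] = F[β ⊙ γ], hence in F[x = b][β′] where
-- b is the value β′ gives to x.  If F is disconnected, the variables of a tree are all
-- linked by co-occurrence in F, so the clauses of F from which its clauses arise lie in a
-- single connected component.

module _ {A : Set} where

  any-≡false⁺ : {p : A → Bool} {xs : List A} → All (λ x → p x ≡ false) xs → any p xs ≡ false
  any-≡false⁺ [] = refl
  any-≡false⁺ (px ∷ pxs) rewrite px = any-≡false⁺ pxs

  any-≡false⁻ : (p : A → Bool) (xs : List A) → any p xs ≡ false → All (λ x → p x ≡ false) xs
  any-≡false⁻ p [] _ = []
  any-≡false⁻ p (x ∷ xs) e with p x in px | e
  ... | false | e′ = px ∷ any-≡false⁻ p xs e′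

  filterᵇ-∧ : (p q r : A → Bool) {xs : List A} → All (λ x → r x ≡ p x ∧ q x) xs →
              filterᵇ r xs ≡ filterᵇ q (filterᵇ p xs)
  filterᵇ-∧ p q r [] = refl
  filterᵇ-∧ p q r {x ∷ _} (rx ∷ rxs) rewrite rx with p x
  ... | false = filterᵇ-∧ p q r rxs
  ... | true with q x
  ...   | true  = cong (x ∷_) (filterᵇ-∧ p q r rxs)
  ...   | false = filterᵇ-∧ p q r rxs

  any-∧ : (p q r : A → Bool) {xs : List A} → All (λ x → r x ≡ p x ∧ q x) xs →
          any r xs ≡ any q (filterᵇ p xs)
  any-∧ p q r [] = refl
  any-∧ p q r {x ∷ _} (rx ∷ rxs) rewrite rx with p x
  ... | false = any-∧ p q r rxs
  ... | true with q x
  ...   | true  = refl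
  ...   | false = any-∧ p q r rxs

_⊙_ : PAssign → PAssign → PAssign
(β ⊙ γ) y = β y <∣> γ y

kept : PAssign → Lit → Bool
kept β l = not (litFalse β l)

module _ {β γ δ : PAssign} (δ≗β⊙γ : δ ≗ β ⊙ γ) where

  litTrue-⊙ : ∀ l → litTrue β l ≡ false → litTrue δ l ≡ kept β l ∧ litTrue γ l
  litTrue-⊙ (y , b) β⊭l rewrite δ≗β⊙γ y with β y | b | β⊭l
  ... | nothing    | _     | _ = refl
  ... | just true  | false | _ = refl
  ... | just false | true  | _ = refl

  kept-⊙ : ∀ l → litTrue β l ≡ false → kept δ l ≡ kept β l ∧ kept γ l
  kept-⊙ (y , b) β⊭l rewrite δ≗β⊙γ y with β y | b | β⊭l
  ... | nothing    | _     | _ = refl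
  ... | just true  | false | _ = refl
  ... | just false | true  | _ = refl

  litTrue-⊙-false : ∀ l → litTrue δ l ≡ false → litTrue β l ≡ false
  litTrue-⊙-false (y , b) δ⊭l rewrite δ≗β⊙γ y with β y
  ... | nothing = refl
  ... | just _  = δ⊭l

  satisfiedC-⊙ : ∀ c → satisfiedC β c ≡ false → satisfiedC δ c ≡ satisfiedC γ (reduceC β c)
  satisfiedC-⊙ c β⊭c =
    any-∧ (kept β) (litTrue γ) (litTrue δ) (All.map (litTrue-⊙ _) (any-≡false⁻ _ c β⊭c))

  reduceC-⊙ : ∀ c → satisfiedC β c ≡ false → reduceC δ c ≡ reduceC γ (reduceC β c)
  reduceC-⊙ c β⊭c =
    filterᵇ-∧ (kept β) (kept γ) (kept δ) (All.map (kept-⊙ _) (any-≡false⁻ _ c β⊭c))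

  satisfiedC-⊙-false : ∀ c → satisfiedC δ c ≡ false → satisfiedC β c ≡ false
  satisfiedC-⊙-false c δ⊭c = any-≡false⁺ (All.map (litTrue-⊙-false _) (any-≡false⁻ _ c δ⊭c))

module _ {F : CNF} {β : PAssign} where

  ∈-⟦⟧⁺ : ∀ {c} → c ∈ F → satisfiedC β c ≡ false → reduceC β c ∈ F ⟦ β ⟧
  ∈-⟦⟧⁺ c∈F β⊭c =
    ∈-map∘filter⁺ (reduceC β) _ (_ , c∈F , refl , Equivalence.from T-not-≡ β⊭c)

  ∈-⟦⟧⁻ : ∀ {t} → t ∈ F ⟦ β ⟧ → ∃[ c ] c ∈ F × satisfiedC β c ≡ false × t ≡ reduceC β c
  ∈-⟦⟧⁻ t∈ with ∈-map∘filter⁻ (reduceC β) _ t∈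
  ... | c , c∈F , t≡ , β⊭c = c , c∈F , Equivalence.to T-not-≡ β⊭c , t≡

module _ {β γ δ : PAssign} (δ≗β⊙γ : δ ≗ β ⊙ γ) {F : CNF} where

  ⟦⟧-⊙⁺ : (F ⟦ β ⟧) ⟦ γ ⟧ ⊆ F ⟦ δ ⟧
  ⟦⟧-⊙⁺ t∈ with ∈-⟦⟧⁻ {F ⟦ β ⟧} {γ} t∈
  ... | t′ , t′∈ , γ⊭t′ , refl with ∈-⟦⟧⁻ {F} {β} t′∈
  ... | c , c∈F , β⊭c , refl =
    subst (_∈ F ⟦ δ ⟧) (reduceC-⊙ δ≗β⊙γ c β⊭c)
      (∈-⟦⟧⁺ c∈F (trans (satisfiedC-⊙ δ≗β⊙γ c β⊭c) γ⊭t′))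

  ⟦⟧-⊙⁻ : F ⟦ δ ⟧ ⊆ (F ⟦ β ⟧) ⟦ γ ⟧
  ⟦⟧-⊙⁻ t∈ with ∈-⟦⟧⁻ {F} {δ} t∈
  ... | c , c∈F , δ⊭c , refl =
    subst (_∈ (F ⟦ β ⟧) ⟦ γ ⟧) (sym (reduceC-⊙ δ≗β⊙γ c β⊭c))
      (∈-⟦⟧⁺ (∈-⟦⟧⁺ c∈F β⊭c) (trans (sym (satisfiedC-⊙ δ≗β⊙γ c β⊭c)) δ⊭c))
    where
    β⊭c : satisfiedC β c ≡ false
    β⊭c = satisfiedC-⊙-false δ≗β⊙γ c δ⊭c

Unassigned : PAssign → Clause → Set
Unassigned γ t = All (λ l → γ (proj₁ l) ≡ nothing) t

∈-⟦⟧-unassigned : ∀ {γ t G} → Unassigned γ t → t ∈ G → t ∈ G ⟦ γ ⟧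
∈-⟦⟧-unassigned {γ} {t} γ∅ t∈G =
  subst (_∈ _) (ListProp.filter-all (T? ∘ kept γ) (All.map keeps γ∅))
    (∈-⟦⟧⁺ t∈G (any-≡false⁺ (All.map falsifies γ∅)))
  where
  falsifies : ∀ {l} → γ (proj₁ l) ≡ nothing → litTrue γ l ≡ false
  falsifies {y , b} e rewrite e = refl
  keeps : ∀ {l} → γ (proj₁ l) ≡ nothing → T (kept γ l)
  keeps {y , b} e rewrite e = _

≔-unassigned : ∀ {x b t} → ¬ Occurs x t → Unassigned (x ≔ b) t
≔-unassigned {x} {b} {t} x∉t = All.map (λ {l} → unassigned {l}) (¬Any⇒All¬ t x∉t)
  where
  unassigned : ∀ {l : Lit} → proj₁ l ≢ x → (x ≔ b) (proj₁ l) ≡ nothing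
  unassigned {y , _} y≢x with y ≡ᵇ x in y≡ᵇx
  ... | false = refl
  ... | true  = ⊥-elim (y≢x (≡ᵇ⇒≡ y x (subst T (sym y≡ᵇx) _)))

⊙-≔-comm : ∀ β x → let b = fromMaybe false (β x) in β ⊙ (x ≔ b) ≗ (x ≔ b) ⊙ β
⊙-≔-comm β x y with y ≡ᵇ x in y≡ᵇx
... | false = <∣>-identityʳ (β y)
... | true rewrite ≡ᵇ⇒≡ y x (subst T (sym y≡ᵇx) _) with β x
...   | just _  = refl
...   | nothing = refl

-- A clause t avoiding x survives x ≔ b unchanged, so t ∈ F⟦β⟧⟦x ≔ b⟧ = F⟦β ⊙ (x ≔ b)⟧,
-- and β ⊙ (x ≔ b) = (x ≔ b) ⊙ β because b is the value of β at x whenever β assigns x.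
⊆-⟦⟧-branch : ∀ {F β ts} x → All (λ t → ¬ Occurs x t) ts → ts ⊆ F ⟦ β ⟧ →
              ts ⊆ (F ⟦ x ≔ fromMaybe false (β x) ⟧) ⟦ β ⟧
⊆-⟦⟧-branch {F} {β} x x∉ts ts⊆ t∈ts =
  ⟦⟧-⊙⁻ (⊙-≔-comm β x) {F}
    (⟦⟧-⊙⁺ {β} {x ≔ fromMaybe false (β x)} (λ _ → refl) {F}
      (∈-⟦⟧-unassigned (≔-unassigned (All.lookup x∉ts t∈ts)) (ts⊆ t∈ts)))

#α-reduceC : ∀ α β c → #α α (reduceC β c) ≤ #α α c
#α-reduceC α β c =
  Sublist.length-mono-≤
    (Sublist.filter⁺ isα? isα? (λ { refl → id }) (Sublist.filter-⊆ (T? ∘ kept β) c))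
  where
  isα? = T? ∘ isαLit α

InC-⟦⟧ : ∀ {α s F} β → InC α s F → InC α s (F ⟦ β ⟧)
InC-⟦⟧ {α} {F = F} β F∈C = All.tabulate λ t∈ → case ∈-⟦⟧⁻ {F} {β} t∈ of λ where
  (c , c∈F , _ , refl) → ≤-trans (#α-reduceC α β c) (All.lookup F∈C c∈F)

_++ʷ_ : ∀ {G u w v} → Walk G u w → Walk G w v → Walk G u v
here _   ++ʷ Q = Q
step e P ++ʷ Q = step e (P ++ʷ Q)

walk-clauses-⊆ : ∀ {G u v} (P : Walk G u v) → clausesOf (walkVerts P) ⊆ G
walk-clauses-⊆ (here {inj₂ _} c∈G) (here refl) = c∈G
walk-clauses-⊆ (step (vc _ _) P) = walk-clauses-⊆ P
walk-clauses-⊆ (step (cv c∈G _) P) (here refl) = c∈G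
walk-clauses-⊆ (step (cv _ _) P) (there t∈P) = walk-clauses-⊆ P t∈P

target∈walkVerts : ∀ {G u v} (P : Walk G u v) → v ∈ walkVerts P
target∈walkVerts (here _) = here refl
target∈walkVerts (step _ P) = there (target∈walkVerts P)

InTree-++⁻ : ∀ {cs₁ cs₂ xs₁ xs₂ ws v} →
             InTree (mkTree (cs₁ ++ cs₂ ++ clausesOf ws) (xs₁ ++ xs₂ ++ varsOf ws)) v →
             InTree (mkTree cs₁ xs₁) v ⊎ InTree (mkTree cs₂ xs₂) v ⊎ v ∈ ws
InTree-++⁻ {cs₁} {cs₂} {xs₁} {xs₂} {ws} {inj₁ x} x∈ with ∈-++⁻ xs₁ x∈
... | inj₁ x∈xs₁ = inj₁ x∈xs₁
... | inj₂ x∈′ with ∈-++⁻ xs₂ x∈′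
...   | inj₁ x∈xs₂ = inj₂ (inj₁ x∈xs₂)
...   | inj₂ x∈ws  = inj₂ (inj₂ (varsOf-∈ ws x∈ws))
  where
  varsOf-∈ : ∀ vs → x ∈ varsOf vs → inj₁ x ∈ vs
  varsOf-∈ (inj₁ _ ∷ vs) (here refl) = here refl
  varsOf-∈ (inj₁ _ ∷ vs) (there x∈vs) = there (varsOf-∈ vs x∈vs)
  varsOf-∈ (inj₂ _ ∷ vs) x∈vs = there (varsOf-∈ vs x∈vs)
InTree-++⁻ {cs₁} {cs₂} {xs₁} {xs₂} {ws} {inj₂ c} c∈ with ∈-++⁻ cs₁ c∈
... | inj₁ c∈cs₁ = inj₁ c∈cs₁
... | inj₂ c∈′ with ∈-++⁻ cs₂ c∈′
...   | inj₁ c∈cs₂ = inj₂ (inj₁ c∈cs₂)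
...   | inj₂ c∈ws  = inj₂ (inj₂ (clausesOf-∈ ws c∈ws))
  where
  clausesOf-∈ : ∀ vs → c ∈ clausesOf vs → inj₂ c ∈ vs
  clausesOf-∈ (inj₁ _ ∷ vs) c∈vs = there (clausesOf-∈ vs c∈vs)
  clausesOf-∈ (inj₂ _ ∷ vs) (here refl) = here refl
  clausesOf-∈ (inj₂ _ ∷ vs) (there c∈vs) = there (clausesOf-∈ vs c∈vs)

reducts-⊆ : ∀ {H G γ L} → All (λ c → c ∈ H × satisfiedC γ c ≡ false) L → L ⊆ G →
            map (reduceC γ) L ⊆ G ⟦ γ ⟧
reducts-⊆ L-ok L⊆G t∈ with ∈-map⁻ (reduceC _) t∈
... | c , c∈L , refl = ∈-⟦⟧⁺ (L⊆G c∈L) (proj₂ (All.lookup L-ok c∈L))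

CoOccur : CNF → Var → Var → Set
CoOccur G a b = ∃[ c ] c ∈ G × Occurs a c × Occurs b c

Linked : CNF → Var → Var → Set
Linked G = Star (CoOccur G)

Linked-sym : ∀ {G a b} → Linked G a b → Linked G b a
Linked-sym = Star.reverse λ (c , c∈G , a∈c , b∈c) → c , c∈G , b∈c , a∈c

Linked-clause : ∀ {G c a b} → c ∈ G → Occurs a c → Occurs b c → Linked G a b
Linked-clause c∈G a∈c b∈c = (_ , c∈G , a∈c , b∈c) ◅ ε

Occurs-reduceC : ∀ {γ a} c → Occurs a (reduceC γ c) → Occurs a c
Occurs-reduceC {γ} c = Subset.Any-resp-⊆ (Subset.filter-⊆ (T? ∘ kept γ) c)

Linked-⟦⟧ : ∀ {G γ a b} → Linked (G ⟦ γ ⟧) a b → Linked G a b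
Linked-⟦⟧ {G} {γ} = Star.map λ (t , t∈ , a∈t , b∈t) → case ∈-⟦⟧⁻ {G} {γ} t∈ of λ where
  (c , c∈G , _ , refl) → c , c∈G , Occurs-reduceC c a∈t , Occurs-reduceC c b∈t

Touches : Vertex → Var → Set
Touches (inj₁ x) a = a ≡ x
Touches (inj₂ c) a = Occurs a c

Reaches : CNF → Var → Vertex → Set
Reaches G y v = ∃[ a ] Touches v a × Linked G y a

Reaches-⟦⟧ : ∀ {G γ y v} → Reaches (G ⟦ γ ⟧) y v → Reaches G y v
Reaches-⟦⟧ (a , a∈v , y~a) = a , a∈v , Linked-⟦⟧ y~a

Reaches-clause : ∀ {G y c b} → Reaches G y (inj₂ c) → c ∈ G → Occurs b c → Linked G y b
Reaches-clause (_ , a∈c , y~a) c∈G b∈c = y~a ◅◅ Linked-clause c∈G a∈c b∈c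

Reaches-join : ∀ {G L xs y z v} → L ⊆ G → InTree (mkTree L xs) v →
               Reaches G y v → Reaches G z v → Linked G y z
Reaches-join {v = inj₁ _} _ _ (_ , refl , y~x) (_ , refl , z~x) = y~x ◅◅ Linked-sym z~x
Reaches-join {v = inj₂ _} L⊆G c∈L r (_ , b∈c , z~b) = Reaches-clause r (L⊆G c∈L) b∈c ◅◅ Linked-sym z~b

walk-reaches : ∀ {H G y u v} (P : Walk H u v) → clausesOf (walkVerts P) ⊆ G →
               Reaches G y u → All (Reaches G y) (walkVerts P)
walk-reaches (here _) _ r = r ∷ []
walk-reaches (step (vc _ x∈c) P) P⊆G r@(_ , refl , y~x) = r ∷ walk-reaches P P⊆G (_ , x∈c , y~x)
walk-reaches (step (cv _ x∈c) P) P⊆G r =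
  r ∷ walk-reaches P (P⊆G ∘ there) (_ , refl , Reaches-clause r (P⊆G (here refl)) x∈c)

Reaches-◅◅ : ∀ {G y z v} → Linked G y z → Reaches G z v → Reaches G y v
Reaches-◅◅ y~z (a , a∈v , z~a) = a , a∈v , y~z ◅◅ z~a

module _ {α : Sign} {s : ℕ} where

  ObsTree-⊆ : ∀ {H k T} → ObsTree α s H k T → tclauses T ⊆ H
  ObsTree-⊆ (leaf _ c∈H _) (here refl) = c∈H
  ObsTree-⊆ (node T₁ _ _ L P 𝒯₁ _ _ L-ok _ _ _ _) t∈ with ∈-++⁻ (tclauses T₁) t∈
  ... | inj₁ t∈T₁ = ObsTree-⊆ 𝒯₁ t∈T₁
  ... | inj₂ t∈′ with ∈-++⁻ L t∈′
  ...   | inj₁ t∈L = proj₁ (All.lookup L-ok t∈L)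
  ...   | inj₂ t∈P = walk-clauses-⊆ P t∈P

  ObsTree-bad : ∀ {H k T} → ObsTree α s H k T → ∃[ t ] t ∈ tclauses T × Bad α s t
  ObsTree-bad (leaf c _ bad) = c , here refl , bad
  ObsTree-bad (node T₁ _ _ _ _ 𝒯₁ _ _ _ _ _ _ _) with ObsTree-bad 𝒯₁
  ... | t , t∈T₁ , bad = t , ∈-++⁺ˡ t∈T₁ , bad

  ObsTree-reaches : ∀ {H G k T} → ObsTree α s H k T → tclauses T ⊆ G →
                    ∃[ y ] (∀ {v} → InTree T v → Reaches G y v)
  ObsTree-reaches (leaf [] _ bad) _ = ⊥-elim (bad (z≤n ∷ []))
  ObsTree-reaches (leaf ((y , _) ∷ _) _ _) _ = y , λ { {inj₂ _} (here refl) → y , here refl , ε }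
  ObsTree-reaches {G = G} (node T₁ γ T₂ L P 𝒯₁ 𝒯₂ _ L-ok L≡ _ u∈T₁ v∈L) T⊆G = y₁ , reaches
    where
    L⊆G : L ⊆ G
    L⊆G = T⊆G ∘ ∈-++⁺ʳ (tclauses T₁) ∘ ∈-++⁺ˡ
    P⊆G : clausesOf (walkVerts P) ⊆ G
    P⊆G = T⊆G ∘ ∈-++⁺ʳ (tclauses T₁) ∘ ∈-++⁺ʳ L
    IH₁ = ObsTree-reaches 𝒯₁ (T⊆G ∘ ∈-++⁺ˡ)
    IH₂ = ObsTree-reaches 𝒯₂ (subst (_⊆ G ⟦ γ ⟧) L≡ (reducts-⊆ L-ok L⊆G))
    y₁ = proj₁ IH₁
    y₂ = proj₁ IH₂
    reachesᴸ : ∀ {v} → InTree (mkTree L (tvars T₂)) v → Reaches G y₂ v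
    reachesᴸ {inj₁ _} x∈T₂ = Reaches-⟦⟧ (proj₂ IH₂ x∈T₂)
    reachesᴸ {inj₂ c} c∈L with proj₂ IH₂ (subst (reduceC γ c ∈_) L≡ (∈-map⁺ (reduceC γ) c∈L))
    ... | a , a∈t , y₂~a = a , Occurs-reduceC c a∈t , Linked-⟦⟧ y₂~a
    reachesᴾ : All (Reaches G y₁) (walkVerts P)
    reachesᴾ = walk-reaches P P⊆G (proj₂ IH₁ u∈T₁)
    y₁~y₂ : Linked G y₁ y₂
    y₁~y₂ = Reaches-join L⊆G v∈L (All.lookup reachesᴾ (target∈walkVerts P)) (reachesᴸ v∈L)
    reaches : ∀ {v} → InTree (mkTree (tclauses T₁ ++ L ++ clausesOf (walkVerts P))
                                      (tvars T₁ ++ tvars T₂ ++ varsOf (walkVerts P))) v →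
              Reaches G y₁ v
    reaches v∈ with InTree-++⁻ {tclauses T₁} {L} {tvars T₁} {tvars T₂} {walkVerts P} v∈
    ... | inj₁ v∈T₁        = proj₂ IH₁ v∈T₁
    ... | inj₂ (inj₁ v∈L)  = Reaches-◅◅ y₁~y₂ (reachesᴸ v∈L)
    ... | inj₂ (inj₂ v∈P)  = All.lookup reachesᴾ v∈P

Linked⇒Walk : ∀ {G c c′ a b} → c ∈ G → Occurs a c → Linked G a b → c′ ∈ G → Occurs b c′ →
              Walk G (inj₂ c) (inj₂ c′)
Linked⇒Walk c∈G a∈c ε c′∈G a∈c′ = step (cv c∈G a∈c) (step (vc c′∈G a∈c′) (here c′∈G))
Linked⇒Walk c∈G a∈c ((d , d∈G , a∈d , x∈d) ◅ x~b) c′∈G b∈c′ =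
  step (cv c∈G a∈c) (step (vc d∈G a∈d) (Linked⇒Walk d∈G x∈d x~b c′∈G b∈c′))

Shares : Clause → Clause → Set
Shares c c′ = Any (λ l → Occurs (proj₁ l) c′) c

shares? : ∀ c c′ → Dec (Shares c c′)
shares? c c′ = any? (λ l → any? (λ l′ → proj₁ l′ ≟ proj₁ l) c′) c

Shares⇒Walk : ∀ {G c c′} → c ∈ G → c′ ∈ G → Shares c c′ → Walk G (inj₂ c) (inj₂ c′)
Shares⇒Walk c∈G c′∈G sh with find sh
... | _ , l∈c , x∈c′ = Linked⇒Walk c∈G (Any.map (cong proj₁ ∘ sym) l∈c) ε c′∈G x∈c′

Near : CNF → Clause → Clause → Set
Near G c c′ = c ∈ G × c′ ∈ G × (c ≡ c′ ⊎ Shares c c′)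

-- Floyd–Warshall: Reach G S c c′ says that c′ is reached from c by Near-steps whose
-- intermediate clauses all lie in S.  It is decidable by recursion on S, and Reach G G is
-- reachability in the incidence graph of G.
Reach : CNF → List Clause → Clause → Clause → Set
Reach G []      c c′ = Near G c c′
Reach G (m ∷ S) c c′ = Reach G S c c′ ⊎ (Reach G S c m × Reach G S m c′)

near? : ∀ G c c′ → Dec (Near G c c′)
near? G c c′ = (c ∈? G) ×-dec (c′ ∈? G) ×-dec (clause-≟ c c′ ⊎-dec shares? c c′)
  where
  clause-≟ : DecidableEquality Clause
  clause-≟ = ListProp.≡-dec (ProductProp.≡-dec _≟_ Bool._≟_)
  open import Data.List.Membership.DecPropositional clause-≟ using (_∈?_)

reach? : ∀ G S c c′ → Dec (Reach G S c c′)
reach? G []      = near? G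
reach? G (m ∷ S) c c′ = reach? G S c c′ ⊎-dec (reach? G S c m ×-dec reach? G S m c′)

Reach⇒Walk : ∀ {G} S {c c′} → Reach G S c c′ → Walk G (inj₂ c) (inj₂ c′)
Reach⇒Walk []      (c∈G , _ , inj₁ refl) = here c∈G
Reach⇒Walk []      (c∈G , c′∈G , inj₂ c~c′) = Shares⇒Walk c∈G c′∈G c~c′
Reach⇒Walk (_ ∷ S) (inj₁ r) = Reach⇒Walk S r
Reach⇒Walk (_ ∷ S) (inj₂ (r , r′)) = Reach⇒Walk S r ++ʷ Reach⇒Walk S r′

Near⇒Reach : ∀ {G} S {c c′} → Near G c c′ → Reach G S c c′
Near⇒Reach []      n = n
Near⇒Reach (_ ∷ S) n = inj₁ (Near⇒Reach S n)

Reach-to-pivot : ∀ {G} m S {c} → Reach G (m ∷ S) c m → Reach G S c m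
Reach-to-pivot _ _ (inj₁ r) = r
Reach-to-pivot _ _ (inj₂ (r , _)) = r

Reach-from-pivot : ∀ {G} m S {c} → Reach G (m ∷ S) m c → Reach G S m c
Reach-from-pivot _ _ (inj₁ r) = r
Reach-from-pivot _ _ (inj₂ (_ , r)) = r

Reach-trans : ∀ {G} S {c m c′} → m ∈ S → Reach G S c m → Reach G S m c′ → Reach G S c c′
Reach-trans (m ∷ S) (here refl) r r′ = inj₂ (Reach-to-pivot m S r , Reach-from-pivot m S r′)
Reach-trans (_ ∷ S) (there m∈S) (inj₁ r) (inj₁ r′) = inj₁ (Reach-trans S m∈S r r′)
Reach-trans (_ ∷ S) (there m∈S) (inj₁ r) (inj₂ (r₁′ , r₂′)) = inj₂ (Reach-trans S m∈S r r₁′ , r₂′)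
Reach-trans (_ ∷ S) (there m∈S) (inj₂ (r₁ , r₂)) (inj₁ r′) = inj₂ (r₁ , Reach-trans S m∈S r₂ r′)
Reach-trans (_ ∷ S) (there m∈S) (inj₂ (r₁ , _)) (inj₂ (_ , r₂′)) = inj₂ (r₁ , r₂′)

Walk⇒Reach : ∀ {G c c′} → Walk G (inj₂ c) (inj₂ c′) → Reach G G c c′
Walk⇒Reach {G} (here c∈G) = Near⇒Reach G (c∈G , c∈G , inj₁ refl)
Walk⇒Reach {G} (step (cv {c = c} c∈G x∈c) (step (vc {c = d} d∈G x∈d) W)) =
  Reach-trans G d∈G (Near⇒Reach G (c∈G , d∈G , inj₂ c~d)) (Walk⇒Reach W)
  where
  c~d : Shares c d
  c~d = Any.map (λ { refl → x∈d }) x∈c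

component : ∀ {G c₀} → c₀ ∈ G →
            ∃[ G′ ] IsComponent G G′ × (∀ {c} → c ∈ G → Walk G (inj₂ c₀) (inj₂ c) → c ∈ G′)
component {G} {c₀} c₀∈G = filter (reach? G G c₀) G , (c₀ , c₀∈G , λ _ → mk⇔ to from) , curry from
  where
  to : ∀ {c} → c ∈ filter (reach? G G c₀) G → c ∈ G × Walk G (inj₂ c₀) (inj₂ c)
  to c∈ = Product.map₂ (Reach⇒Walk G) (∈-filter⁻ (reach? G G c₀) c∈)
  from : ∀ {c} → c ∈ G × Walk G (inj₂ c₀) (inj₂ c) → c ∈ filter (reach? G G c₀) G
  from (c∈G , W) = ∈-filter⁺ (reach? G G c₀) c∈G (Walk⇒Reach W)

⊆-component : ∀ {F β y t₀ ts} → t₀ ∈ ts → (∀ {t} → t ∈ ts → Reaches F y (inj₂ t)) →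
              ts ⊆ F ⟦ β ⟧ → ∃[ F′ ] IsComponent F F′ × ts ⊆ F′ ⟦ β ⟧
⊆-component {F} {β} {ts = ts} t₀∈ts reaches ts⊆ with ∈-⟦⟧⁻ {F} {β} (ts⊆ t₀∈ts) | reaches t₀∈ts
... | c₀ , c₀∈F , _ , refl | a₀ , a₀∈t₀ , y~a₀ with component c₀∈F
...   | F′ , F′-comp , closed = F′ , F′-comp , ts⊆F′
  where
  ts⊆F′ : ∀ {t} → t ∈ ts → t ∈ F′ ⟦ β ⟧
  ts⊆F′ t∈ts with ∈-⟦⟧⁻ {F} {β} (ts⊆ t∈ts) | reaches t∈ts
  ... | c , c∈F , β⊭c , refl | a , a∈t , y~a =
    ∈-⟦⟧⁺ (closed c∈F c₀⇝c) β⊭c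
    where
    c₀⇝c : Walk F (inj₂ c₀) (inj₂ c)
    c₀⇝c = Linked⇒Walk c₀∈F (Occurs-reduceC c₀ a₀∈t₀) (Linked-sym y~a₀ ◅◅ y~a) c∈F (Occurs-reduceC c a∈t)

module _ (α : Sign) (s : ℕ) where

  Unobstructed : CNF → ℕ → Set
  Unobstructed F k = ∀ {H T β} → ObsTree α s H k T → tclauses T ⊆ F ⟦ β ⟧ → ⊥

  InC⇒Unobstructed : ∀ {F k} → InC α s F → Unobstructed F k
  InC⇒Unobstructed F∈C {β = β} 𝒯 T⊆ with ObsTree-bad 𝒯
  ... | _ , t∈T , bad = bad (All.lookup (InC-⟦⟧ β F∈C) (T⊆ t∈T) ∷ [])

  split⇒Unobstructed : ∀ {F k} x → (∀ b → Unobstructed (F ⟦ x ≔ b ⟧) k) → Unobstructed F (suc k)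
  split⇒Unobstructed {F} x branch {β = β} (node T₁ γ T₂ L _ 𝒯₁ 𝒯₂ disjoint L-ok L≡ _ _ _) T⊆ =
    case any? (λ t → any? (λ l → proj₁ l ≟ x) t) (tclauses T₁) of λ where
      (no x∉T₁)  → branch _ 𝒯₁ (⊆-⟦⟧-branch {F} {β} x (¬Any⇒All¬ _ x∉T₁) (T⊆ ∘ ∈-++⁺ˡ))
      (yes x∈T₁) → branch _ 𝒯₂ (⊆-⟦⟧-branch {F} {β ⊙ γ} x (x∉T₂ x∈T₁) T₂⊆)
    where
    T₂⊆ : tclauses T₂ ⊆ F ⟦ β ⊙ γ ⟧
    T₂⊆ = ⟦⟧-⊙⁺ {β} {γ} (λ _ → refl) {F}
          ∘ subst (_⊆ (F ⟦ β ⟧) ⟦ γ ⟧) L≡ (reducts-⊆ L-ok (T⊆ ∘ ∈-++⁺ʳ (tclauses T₁) ∘ ∈-++⁺ˡ))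
    x∉T₂ : Any (Occurs x) (tclauses T₁) → All (λ t → ¬ Occurs x t) (tclauses T₂)
    x∉T₂ x∈T₁ = All.tabulate λ {t} t∈T₂ x∈t →
      disjoint x (t , ObsTree-⊆ 𝒯₂ t∈T₂ , x∈t) (find x∈T₁ , t , t∈T₂ , x∈t)

  disc⇒Unobstructed : ∀ {F k} → (∀ F′ → IsComponent F F′ → Unobstructed F′ k) → Unobstructed F k
  disc⇒Unobstructed {F} components {β = β} 𝒯 T⊆ with ObsTree-bad 𝒯 | ObsTree-reaches 𝒯 T⊆
  ... | _ , t₀∈T , _ | _ , reaches with ⊆-component {F} {β} t₀∈T (Reaches-⟦⟧ ∘ reaches) T⊆
  ...   | F′ , F′-comp , T⊆F′ = components F′ F′-comp 𝒯 T⊆F′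

  DepthLE⇒Unobstructed : ∀ {F k} → DepthLE α s F k → Unobstructed F k
  DepthLE⇒Unobstructed (inC F∈C) = InC⇒Unobstructed F∈C
  DepthLE⇒Unobstructed {F} (split x _ _ _ D₀ D₁) = split⇒Unobstructed {F} x λ where
    false → DepthLE⇒Unobstructed D₀
    true  → DepthLE⇒Unobstructed D₁
  DepthLE⇒Unobstructed (disc _ _ D) =
    disc⇒Unobstructed λ F′ F′-comp → DepthLE⇒Unobstructed (D F′ F′-comp)

mainTheorem5 : (α : Sign) → NonEmptySign α → (s : ℕ) → (F : CNF) → WFCNF F →
    (d : ℕ) → (T : Tree) → ObsTree α s F d T → ¬ DepthLE α s F d
mainTheorem5 α _ s F _ d T 𝒯 D =
  DepthLE⇒Unobstructed α s D {β = λ _ → nothing} 𝒯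
    λ t∈T → ∈-⟦⟧-unassigned {G = F} (All.tabulate λ _ → refl) (ObsTree-⊆ 𝒯 t∈T)
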